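{- Every theorem of the formal system ATM described in the context is a grounded sentence.
   Context: The formal system ATM is defined as follows. Terms: $\dot{\bot}$ and $L_1, L_2, L_3,\ldots$ are constant symbols, and each is a term. If $s,t$ are terms, then so are $(s\,\dot{\wedge}\,t)$, $(s\,\dot{\vee}\,t)$, $(s\,\dot{\to}\,t)$, $\dot{\mathbb{A}}[t]$, $\dot{\mathbb{T}}[t]$, $\dot{\mathbb{M}}[t]$. All terms arise this way; there are no variables. Abbreviations: $\dot{\neg}t$ is $t\,\dot{\to}\,\dot{\bot}$, and $s\,\dot{\leftrightarrow}\,t$ is $(s\,\dot{\to}\,t)\,\dot{\wedge}\,(t\,\dot{\to}\,s)$. Sentences: the atomic sentences are $\bot$ and $\mathbb{A}[t]$, $\mathbb{T}[t]$, $\mathbb{M}[t]$ for each term $t$. If $\phi,\psi$ are sentences, so are $(\phi\wedge\psi)$, $(\phi\vee\psi)$, $(\phi\to\psi)$. Abbreviations: $\neg\phi$ is $\phi\to\bot$, and $\phi\leftrightarrow\psi$ is $(\phi\to\psi)\wedge(\psi\to\phi)$. Quotation and evaluation: for a sentence $\phi$, $\dot{\phi}$ is the term obtained by putting dots on every $\bot,\wedge,\vee,\to,\mathbb{A},\mathbb{T},\mathbb{M}$ in $\phi$. Each term $t$ evaluates to a sentence $\hat{t}$: $\dot{\bot}$ evaluates to $\bot$; $\dot{\mathbb{A}}[t]$, $\dot{\mathbb{T}}[t]$, $\dot{\mathbb{M}}[t]$ evaluate to $\mathbb{A}[t]$, $\mathbb{T}[t]$, $\mathbb{M}[t]$ respectively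 (with $t$ unchanged); $s\,\dot{\wedge}\,t$, $s\,\dot{\vee}\,t$, $s\,\dot{\to}\,t$ evaluate to $\hat{s}\wedge\hat{t}$, $\hat{s}\vee\hat{t}$, $\hat{s}\to\hat{t}$; and each $L_i$ evaluates to a fixed sentence $\theta_i$, where $\theta_1$ is $\neg\mathbb{T}[L_1]$, $\theta_2$ is $\neg\mathbb{A}[L_2]$, and the remaining $\theta_i$ ($i\ge 3$) are arbitrary fixed sentences. Thus $\hat{\dot{\phi}}=\phi$. Groundedness: the grounded sentences form the smallest set of sentences such that $\bot$ is grounded; $\mathbb{A}[t]$ and $\mathbb{M}[t]$ are grounded for every term $t$; if $\phi,\psi$ are grounded then so are $\phi\wedge\psi$, $\phi\vee\psi$, $\phi\to\psi$; and if $\hat{t}$ is grounded then $\mathbb{T}[t]$ is grounded. Logical axioms: all sentences $(\mathbb{M}[s]\wedge\mathbb{M}[t]\wedge\mathbb{M}[u])\to\mathbb{A}[\dot{A}(s,t,u)]$ for terms $s,t,u$, where $A$ ranges over the standard Hilbert-style axiom schemes of intuitionistic propositional logic and $\dot{A}(s,t,u)$ is the term obtained by instantiating the scheme with $s,t,u$ using the dotted connectives (e.g. $s\,\dot{\wedge}\,t\,\dot{\to}\,s$). Nonlogical axioms (for all terms $s,t,t'$): (1) $\mathbb{M}[t]$, whenever $\hat{t}$ is grounded; (2) $(\mathbb{M}[s]\wedge\mathbb{M}[t])\leftrightarrow\mathbb{M}[s\,\dot{\wedge}\,t]\leftrightarrow\mathbb{M}[s\,\dot{\vee}\,t]\leftrightarrow\mathbb{M}[s\,\dot{\to}\,t]$;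 (3) $\mathbb{A}[t]\to\mathbb{M}[t]$; (4) $(\mathbb{A}[s]\wedge\mathbb{A}[t])\to\mathbb{A}[s\,\dot{\wedge}\,t]$; (5) $(\mathbb{A}[s]\wedge\mathbb{A}[s\,\dot{\to}\,t])\to\mathbb{A}[t]$; (6) $\mathbb{M}[t]\to\mathbb{A}[t\,\dot{\to}\,\dot{\mathbb{A}}[t]]$; (7) $\mathbb{M}[t]\to\mathbb{A}[t\,\dot{\leftrightarrow}\,\dot{\mathbb{T}}[t]]$; (8) $\neg\mathbb{M}[t]\to\mathbb{A}[\dot{\neg}\dot{\mathbb{T}}[t]]$; (9) $\mathbb{M}[t]\to\mathbb{A}[t\,\dot{\leftrightarrow}\,t']$, whenever $\hat{t}=\hat{t}'$. Rules of inference: from $\phi$ and $\psi$ infer $\phi\wedge\psi$; from $\phi$ and $\phi\to\psi$ infer $\psi$ (modus ponens); from $\mathbb{A}[t]$ infer $\hat{t}$ (release). A theorem of ATM is a sentence derivable from the axioms by these rules. -}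

module Defs where

open import Data.Nat using (ℕ; zero; suc)
open import Relation.Binary.PropositionalEquality using (_≡_)

-- Terms of ATM.  The constant  L n  stands for the paper's  L_{n+1}
-- (so  L 0 = L_1,  L 1 = L_2,  L (suc (suc k)) = L_{k+3}).
data Term : Set where
  ⊥̇   : Term
  L   : ℕ → Term
  _∧̇_ : Term → Term → Term
  _∨̇_ : Term → Term → Term
  _→̇_ : Term → Term → Term
  Ȧ   : Term → Term
  Ṫ   : Term → Term
  Ṁ   : Term → Term

infixr 6 _∧̇_
infixr 5 _∨̇_
infixr 4 _→̇_

data Sentence : Set where
  ⊥′  : Sentence
  𝔸   : Term → Sentence
  𝕋   : Term → Sentence
  𝕄   : Term → Sentence
  _∧_ : Sentence → Sentence → Sentence
  _∨_ : Sentence → Sentence → Sentence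
  _⇒_ : Sentence → Sentence → Sentence

infixr 6 _∧_
infixr 5 _∨_
infixr 4 _⇒_

¬̇_ : Term → Term
¬̇ t = t →̇ ⊥̇

_↔̇_ : Term → Term → Term
s ↔̇ t = (s →̇ t) ∧̇ (t →̇ s)

¬′_ : Sentence → Sentence
¬′ φ = φ ⇒ ⊥′

_⇔′_ : Sentence → Sentence → Sentence
φ ⇔′ ψ = (φ ⇒ ψ) ∧ (ψ ⇒ φ)

infix 3 _↔̇_ _⇔′_

quote′ : Sentence → Term
quote′ ⊥′      = ⊥̇
quote′ (𝔸 t)   = Ȧ t
quote′ (𝕋 t)   = Ṫ t
quote′ (𝕄 t)   = Ṁ t
quote′ (φ ∧ ψ) = quote′ φ ∧̇ quote′ ψ
quote′ (φ ∨ ψ) = quote′ φ ∨̇ quote′ ψ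
quote′ (φ ⇒ ψ) = quote′ φ →̇ quote′ ψ

-- The fixed sentences θ_i.  θ_1 = ¬T[L_1], θ_2 = ¬A[L_2]; the sentences
-- θ_{k+3} are arbitrary and given by a parameter  rest : ℕ → Sentence
-- (rest k = θ_{k+3}).
θ : (ℕ → Sentence) → ℕ → Sentence
θ rest zero          = ¬′ 𝕋 (L 0)
θ rest (suc zero)    = ¬′ 𝔸 (L 1)
θ rest (suc (suc k)) = rest k

eval : (ℕ → Sentence) → Term → Sentence
eval rest ⊥̇       = ⊥′
eval rest (L n)   = θ rest n
eval rest (s ∧̇ t) = eval rest s ∧ eval rest t
eval rest (s ∨̇ t) = eval rest s ∨ eval rest t
eval rest (s →̇ t) = eval rest s ⇒ eval rest t
eval rest (Ȧ t)   = 𝔸 t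
eval rest (Ṫ t)   = 𝕋 t
eval rest (Ṁ t)   = 𝕄 t

module ATM (rest : ℕ → Sentence) where

  ^_ : Term → Sentence
  ^ t = eval rest t

  data Grounded : Sentence → Set where
    g⊥ : Grounded ⊥′
    g𝔸 : ∀ t → Grounded (𝔸 t)
    g𝕄 : ∀ t → Grounded (𝕄 t)
    g∧ : ∀ {φ ψ} → Grounded φ → Grounded ψ → Grounded (φ ∧ ψ)
    g∨ : ∀ {φ ψ} → Grounded φ → Grounded ψ → Grounded (φ ∨ ψ)
    g⇒ : ∀ {φ ψ} → Grounded φ → Grounded ψ → Grounded (φ ⇒ ψ)
    g𝕋 : ∀ {t} → Grounded (^ t) → Grounded (𝕋 t)

  data IPCAxiom (s t u : Term) : Term → Set where
    K   : IPCAxiom s t u (s →̇ (t →̇ s))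
    S   : IPCAxiom s t u ((s →̇ (t →̇ u)) →̇ ((s →̇ t) →̇ (s →̇ u)))
    ∧E₁ : IPCAxiom s t u (s ∧̇ t →̇ s)
    ∧E₂ : IPCAxiom s t u (s ∧̇ t →̇ t)
    ∧I  : IPCAxiom s t u (s →̇ (t →̇ s ∧̇ t))
    ∨I₁ : IPCAxiom s t u (s →̇ s ∨̇ t)
    ∨I₂ : IPCAxiom s t u (t →̇ s ∨̇ t)
    ∨E  : IPCAxiom s t u ((s →̇ u) →̇ ((t →̇ u) →̇ (s ∨̇ t →̇ u)))
    EFQ : IPCAxiom s t u (⊥̇ →̇ s)

  data Axiom : Sentence → Set where
    logical : ∀ s t u a → IPCAxiom s t u a →
              Axiom ((𝕄 s ∧ 𝕄 t ∧ 𝕄 u) ⇒ 𝔸 a)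
    ax1   : ∀ t → Grounded (^ t) → Axiom (𝕄 t)
    ax2a  : ∀ s t → Axiom ((𝕄 s ∧ 𝕄 t) ⇔′ 𝕄 (s ∧̇ t))
    ax2b  : ∀ s t → Axiom (𝕄 (s ∧̇ t) ⇔′ 𝕄 (s ∨̇ t))
    ax2c  : ∀ s t → Axiom (𝕄 (s ∨̇ t) ⇔′ 𝕄 (s →̇ t))
    ax3   : ∀ t → Axiom (𝔸 t ⇒ 𝕄 t)
    ax4   : ∀ s t → Axiom ((𝔸 s ∧ 𝔸 t) ⇒ 𝔸 (s ∧̇ t))
    ax5   : ∀ s t → Axiom ((𝔸 s ∧ 𝔸 (s →̇ t)) ⇒ 𝔸 t)
    ax6   : ∀ t → Axiom (𝕄 t ⇒ 𝔸 (t →̇ Ȧ t))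
    ax7   : ∀ t → Axiom (𝕄 t ⇒ 𝔸 (t ↔̇ Ṫ t))
    ax8   : ∀ t → Axiom (¬′ 𝕄 t ⇒ 𝔸 (¬̇ Ṫ t))
    ax9   : ∀ t t′ → ^ t ≡ ^ t′ → Axiom (𝕄 t ⇒ 𝔸 (t ↔̇ t′))

  data Theorem : Sentence → Set where
    axiom   : ∀ {φ} → Axiom φ → Theorem φ
    conj    : ∀ {φ ψ} → Theorem φ → Theorem ψ → Theorem (φ ∧ ψ)
    mp      : ∀ {φ ψ} → Theorem φ → Theorem (φ ⇒ ψ) → Theorem ψ
    release : ∀ {t} → Theorem (𝔸 t) → Theorem (^ t)

-- Interpret grounded sentences in a step-indexed Kripke model whose stages are
-- the natural numbers, stage k seeing every stage j ≤ k.  At stage 0 every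
-- 𝔸[t] and 𝕄[t] holds; at stage n+1, 𝕄[t] holds iff t̂ is grounded and 𝔸[t]
-- holds iff t̂ is grounded and holds at stage n; 𝕋[t] is interpreted as t̂.
-- The interpretation is by recursion on groundedness derivations, so only
-- grounded sentences receive one, and since these derivations are unique it
-- does not depend on the derivation chosen.  Every axiom is grounded and holds
-- at all stages, and the rules preserve this; release goes through because
-- 𝔸[t] at stage k+1 yields t̂ at stage k.
module Submission where

open import Defs
open import Data.Nat using (ℕ; zero; suc; _≤_; _≤′_; z≤n)
open import Data.Nat.Base using (≤′-refl; ≤′-step)
open import Data.Nat.Properties using (≤-refl; ≤-trans; m≤n⇒m≤1+n; ≤⇒≤′)
open import Data.Product using (Σ; _×_; _,_; proj₁; proj₂)
open import Data.Sum using (_⊎_; inj₁; inj₂)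
open import Data.Unit using (⊤; tt)
open import Data.Empty using (⊥; ⊥-elim)
open import Relation.Nullary.Irrelevant using (Irrelevant)
open import Relation.Binary.PropositionalEquality using (_≡_; refl)

module _ (rest : ℕ → Sentence) where
  open ATM rest

  Grounded-irrelevant : ∀ {φ} → Irrelevant (Grounded φ)
  Grounded-irrelevant g⊥       g⊥         = refl
  Grounded-irrelevant (g𝔸 t)   (g𝔸 .t)    = refl
  Grounded-irrelevant (g𝕄 t)   (g𝕄 .t)    = refl
  Grounded-irrelevant (g∧ a b) (g∧ a′ b′)
    with refl ← Grounded-irrelevant a a′ | refl ← Grounded-irrelevant b b′ = refl
  Grounded-irrelevant (g∨ a b) (g∨ a′ b′)
    with refl ← Grounded-irrelevant a a′ | refl ← Grounded-irrelevant b b′ = refl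
  Grounded-irrelevant (g⇒ a b) (g⇒ a′ b′)
    with refl ← Grounded-irrelevant a a′ | refl ← Grounded-irrelevant b b′ = refl
  Grounded-irrelevant (g𝕋 a)   (g𝕋 a′)
    with refl ← Grounded-irrelevant a a′ = refl

  infix 4 _⊩_

  -- An implication at stage k+1 is unfolded into "at k+1" and "at k", so that
  -- the definition terminates by lexicographic recursion on (stage, derivation).
  _⊩_ : ∀ {φ} → ℕ → Grounded φ → Set
  _     ⊩ g⊥     = ⊥
  zero  ⊩ g𝔸 t   = ⊤
  suc n ⊩ g𝔸 t   = Σ (Grounded (^ t)) (n ⊩_)
  zero  ⊩ g𝕄 t   = ⊤
  suc n ⊩ g𝕄 t   = Grounded (^ t)
  k     ⊩ g∧ a b = k ⊩ a × k ⊩ b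
  k     ⊩ g∨ a b = k ⊩ a ⊎ k ⊩ b
  zero  ⊩ g⇒ a b = zero ⊩ a → zero ⊩ b
  suc n ⊩ g⇒ a b = (suc n ⊩ a → suc n ⊩ b) × n ⊩ g⇒ a b
  k     ⊩ g𝕋 a   = k ⊩ a

  ⊩-cast : ∀ {φ k} (g g′ : Grounded φ) → k ⊩ g → k ⊩ g′
  ⊩-cast g g′ x with refl ← Grounded-irrelevant g g′ = x

  ⊩-step : ∀ {φ n} (g : Grounded φ) → suc n ⊩ g → n ⊩ g
  ⊩-step             g⊥       ()
  ⊩-step {n = zero}  (g𝔸 t)   _        = tt
  ⊩-step {n = suc n} (g𝔸 t)   (g , x)  = g , ⊩-step g x
  ⊩-step {n = zero}  (g𝕄 t)   _        = tt
  ⊩-step {n = suc n} (g𝕄 t)   g        = g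
  ⊩-step             (g∧ a b) (x , y)  = ⊩-step a x , ⊩-step b y
  ⊩-step             (g∨ a b) (inj₁ x) = inj₁ (⊩-step a x)
  ⊩-step             (g∨ a b) (inj₂ y) = inj₂ (⊩-step b y)
  ⊩-step             (g⇒ a b) (_ , f)  = f
  ⊩-step             (g𝕋 a)   x        = ⊩-step a x

  ⊩-mono : ∀ {φ j k} (g : Grounded φ) → j ≤ k → k ⊩ g → j ⊩ g
  ⊩-mono {j = j} g j≤k = go (≤⇒≤′ j≤k)
    where
      go : ∀ {k} → j ≤′ k → k ⊩ g → j ⊩ g
      go ≤′-refl        x = x
      go (≤′-step j≤k) x = go j≤k (⊩-step g x)

  ⊩⇒-intro : ∀ {φ ψ} {a : Grounded φ} {b : Grounded ψ} k →
             (∀ j → j ≤ k → j ⊩ a → j ⊩ b) → k ⊩ g⇒ a b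
  ⊩⇒-intro zero    f = f zero z≤n
  ⊩⇒-intro (suc n) f = f (suc n) ≤-refl , ⊩⇒-intro n (λ j j≤n → f j (m≤n⇒m≤1+n j≤n))

  ⊩⇒-elim : ∀ {φ ψ} {a : Grounded φ} {b : Grounded ψ} k → k ⊩ g⇒ a b → k ⊩ a → k ⊩ b
  ⊩⇒-elim zero    f       x = f x
  ⊩⇒-elim (suc n) (f , _) x = f x

  Valid : Sentence → Set
  Valid φ = Σ (Grounded φ) (λ g → ∀ k → k ⊩ g)

  valid-at : ∀ {φ} → Valid φ → ∀ k → Σ (Grounded φ) (k ⊩_)
  valid-at (g , v) k = g , v k

  valid-∧ : ∀ {φ ψ} → Valid φ → Valid ψ → Valid (φ ∧ ψ)
  valid-∧ (g , v) (h , w) = g∧ g h , λ k → v k , w k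

  valid-⇒ : ∀ {φ ψ} (a : Grounded φ) (b : Grounded ψ) →
            (∀ {k} → k ⊩ a → k ⊩ b) → Valid (φ ⇒ ψ)
  valid-⇒ a b f = g⇒ a b , λ k → ⊩⇒-intro k (λ _ _ → f)

  valid-⇔ : ∀ {φ ψ} (a : Grounded φ) (b : Grounded ψ) →
            (∀ {k} → k ⊩ a → k ⊩ b) → (∀ {k} → k ⊩ b → k ⊩ a) → Valid (φ ⇔′ ψ)
  valid-⇔ a b f g = valid-∧ (valid-⇒ a b f) (valid-⇒ b a g)

  valid-⇒𝔸 : ∀ {φ c} (a : Grounded φ) →
             (∀ n → suc n ⊩ a → Σ (Grounded (^ c)) (n ⊩_)) → Valid (φ ⇒ 𝔸 c)
  valid-⇒𝔸 {c = c} a f = valid-⇒ a (g𝔸 c) λ { {zero} _ → tt ; {suc n} → f n }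

  valid-mp : ∀ {φ ψ} → Valid φ → Valid (φ ⇒ ψ) → Valid ψ
  valid-mp (g , v) (g⇒ a b , w) = b , λ k → ⊩⇒-elim k (w k) (⊩-cast g a (v k))

  valid-release : ∀ {t} → Valid (𝔸 t) → Valid (^ t)
  valid-release (g𝔸 t , v) with (g , _) ← v 1 =
    g , λ k → let (g′ , x) = v (suc k) in ⊩-cast g′ g x

  ipc-valid : ∀ {s t u a} → IPCAxiom s t u a →
              Grounded (^ s) → Grounded (^ t) → Grounded (^ u) → Valid (^ a)
  ipc-valid K gs gt gu = g⇒ gs (g⇒ gt gs) ,
    λ i → ⊩⇒-intro i λ j _ x → ⊩⇒-intro j λ l l≤j _ → ⊩-mono gs l≤j x
  ipc-valid S gs gt gu = g⇒ (g⇒ gs (g⇒ gt gu)) (g⇒ (g⇒ gs gt) (g⇒ gs gu)) ,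
    λ i → ⊩⇒-intro i λ j _ f → ⊩⇒-intro j λ l l≤j h → ⊩⇒-intro l λ m m≤l x →
      ⊩⇒-elim m (⊩⇒-elim m (⊩-mono (g⇒ gs (g⇒ gt gu)) (≤-trans m≤l l≤j) f) x)
                (⊩⇒-elim m (⊩-mono (g⇒ gs gt) m≤l h) x)
  ipc-valid ∧E₁ gs gt gu = valid-⇒ (g∧ gs gt) gs proj₁
  ipc-valid ∧E₂ gs gt gu = valid-⇒ (g∧ gs gt) gt proj₂
  ipc-valid ∧I  gs gt gu = g⇒ gs (g⇒ gt (g∧ gs gt)) ,
    λ i → ⊩⇒-intro i λ j _ x → ⊩⇒-intro j λ l l≤j y → ⊩-mono gs l≤j x , y
  ipc-valid ∨I₁ gs gt gu = valid-⇒ gs (g∨ gs gt) inj₁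
  ipc-valid ∨I₂ gs gt gu = valid-⇒ gt (g∨ gs gt) inj₂
  ipc-valid ∨E  gs gt gu = g⇒ (g⇒ gs gu) (g⇒ (g⇒ gt gu) (g⇒ (g∨ gs gt) gu)) ,
    λ i → ⊩⇒-intro i λ j _ f → ⊩⇒-intro j λ l l≤j h → ⊩⇒-intro l λ m m≤l x →
      cases m (⊩-mono (g⇒ gs gu) (≤-trans m≤l l≤j) f) (⊩-mono (g⇒ gt gu) m≤l h) x
    where
      cases : ∀ m → m ⊩ g⇒ gs gu → m ⊩ g⇒ gt gu → m ⊩ g∨ gs gt → m ⊩ gu
      cases m f h (inj₁ x) = ⊩⇒-elim m f x
      cases m f h (inj₂ y) = ⊩⇒-elim m h y
  ipc-valid EFQ gs gt gu = valid-⇒ g⊥ gs λ ()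

  valid-⇔-≡ : ∀ {φ ψ} → φ ≡ ψ → Grounded φ → Valid (φ ⇔′ ψ)
  valid-⇔-≡ refl g = valid-⇔ g g (λ x → x) (λ x → x)

  axiom-valid : ∀ {φ} → Axiom φ → Valid φ
  axiom-valid (logical s t u a ax) = valid-⇒𝔸 (g∧ (g𝕄 s) (g∧ (g𝕄 t) (g𝕄 u)))
    λ { n (gs , gt , gu) → valid-at (ipc-valid ax gs gt gu) n }
  axiom-valid (ax1 t g) = g𝕄 t , λ { zero → tt ; (suc _) → g }
  axiom-valid (ax2a s t) = valid-⇔ (g∧ (g𝕄 s) (g𝕄 t)) (g𝕄 (s ∧̇ t))
    (λ { {zero} _ → tt ; {suc _} (x , y) → g∧ x y })
    (λ { {zero} _ → tt , tt ; {suc _} (g∧ x y) → x , y })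
  axiom-valid (ax2b s t) = valid-⇔ (g𝕄 (s ∧̇ t)) (g𝕄 (s ∨̇ t))
    (λ { {zero} _ → tt ; {suc _} (g∧ x y) → g∨ x y })
    (λ { {zero} _ → tt ; {suc _} (g∨ x y) → g∧ x y })
  axiom-valid (ax2c s t) = valid-⇔ (g𝕄 (s ∨̇ t)) (g𝕄 (s →̇ t))
    (λ { {zero} _ → tt ; {suc _} (g∨ x y) → g⇒ x y })
    (λ { {zero} _ → tt ; {suc _} (g⇒ x y) → g∨ x y })
  axiom-valid (ax3 t) = valid-⇒ (g𝔸 t) (g𝕄 t) λ { {zero} _ → tt ; {suc _} → proj₁ }
  axiom-valid (ax4 s t) = valid-⇒𝔸 (g∧ (g𝔸 s) (g𝔸 t))
    λ { n ((gs , x) , (gt , y)) → g∧ gs gt , x , y }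
  axiom-valid (ax5 s t) = valid-⇒𝔸 (g∧ (g𝔸 s) (g𝔸 (s →̇ t)))
    λ { n ((gs , x) , (g⇒ a b , f)) → b , ⊩⇒-elim n f (⊩-cast gs a x) }
  axiom-valid (ax6 t) = valid-⇒𝔸 (g𝕄 t) λ n g →
    valid-at (valid-⇒ g (g𝔸 t) λ { {zero} _ → tt ; {suc _} x → g , ⊩-step g x }) n
  axiom-valid (ax7 t) = valid-⇒𝔸 (g𝕄 t) λ n g → valid-at (valid-⇔ g (g𝕋 g) (λ x → x) (λ x → x)) n
  -- ¬𝕄[t] fails already at stage 0, where 𝕄[t] holds, so the premise never holds.
  axiom-valid (ax8 t) = valid-⇒𝔸 (g⇒ (g𝕄 t) g⊥) λ n f →
    ⊥-elim (⊩-mono {k = suc n} (g⇒ (g𝕄 t) g⊥) z≤n f tt)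
  axiom-valid (ax9 t t′ eq) = valid-⇒𝔸 (g𝕄 t) λ n g → valid-at (valid-⇔-≡ eq g) n

  theorem-valid : ∀ {φ} → Theorem φ → Valid φ
  theorem-valid (axiom ax)  = axiom-valid ax
  theorem-valid (conj p q)  = valid-∧ (theorem-valid p) (theorem-valid q)
  theorem-valid (mp p q)    = valid-mp (theorem-valid p) (theorem-valid q)
  theorem-valid (release p) = valid-release (theorem-valid p)

corollary4p2 : (rest : ℕ → Sentence) (φ : Sentence) →
                 ATM.Theorem rest φ → ATM.Grounded rest φ
corollary4p2 rest φ p = proj₁ (theorem-valid rest p)
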